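{- Let $C_1$ and $C_2$ be monochromatic directed cycles (each with all arcs of one color, $1$ or $2$). Then $G=C_1\square C_2$ has a bikernel if and only if $C_1$ and $C_2$ have the same length and have opposite colors.
   Context: The Cartesian product $D_1\square D_2$ of bicolored digraphs has vertex set $V(D_1)\times V(D_2)$ and arcs $((u,v_1),(u,v_2))$ for $u\in V(D_1)$, $(v_1,v_2)\in A(D_2)$, and $((u_1,v),(u_2,v))$ for $v\in V(D_2)$, $(u_1,u_2)\in A(D_1)$, each colored with the color of the corresponding arc in $D_1$ or $D_2$. A non-empty set $B\subseteq V(G)$ is a bikernel (by monochromatic paths) if: (i) for all distinct $u,v\in B$ there is no monochromatic directed $uv$-path; (ii) for every $v\in V(G)\setminus B$ there is a directed path of color $1$ from $v$ to a vertex of $B$; (iii) for every $v\in V(G)\setminus B$ there is a directed path of color $2$ from a vertex of $B$ to $v$. -}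

module Defs where

open import Level using (Level; 0ℓ) renaming (suc to lsuc)
open import Data.Nat using (ℕ; zero; suc)
open import Data.Nat.DivMod using (_%_; m%n<n)
open import Data.Fin using (Fin; toℕ; fromℕ<)
open import Data.Product using (Σ; ∃; _×_; _,_)
open import Data.List using (List; []; _∷_)
open import Data.List.Relation.Unary.Unique.Propositional using (Unique)
open import Relation.Binary.PropositionalEquality using (_≡_; _≢_)
open import Relation.Nullary using (¬_)

data Color : Set where
  c1 c2 : Color

record BiDigraph : Set₁ where
  field
    V : Set
    A : Color → V → V → Set
open BiDigraph public

data Walk (G : BiDigraph) (c : Color) : V G → V G → Set where
  []  : ∀ {u} → Walk G c u u
  _∷_ : ∀ {u v w} → A G c u v → Walk G c v w → Walk G c u w

verts : ∀ {G c u v} → Walk G c u v → List (V G)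
verts {u = u} []       = u ∷ []
verts {u = u} (_ ∷ w)  = u ∷ verts w

Path : (G : BiDigraph) → Color → V G → V G → Set
Path G c u v = Σ (Walk G c u v) λ w → Unique (verts w)

data ProdArc (G H : BiDigraph) (c : Color) : (V G × V H) → (V G × V H) → Set where
  right : ∀ {u v₁ v₂} → A H c v₁ v₂ → ProdArc G H c (u , v₁) (u , v₂)
  left  : ∀ {u₁ u₂ v} → A G c u₁ u₂ → ProdArc G H c (u₁ , v) (u₂ , v)

_□_ : BiDigraph → BiDigraph → BiDigraph
G □ H = record { V = V G × V H ; A = ProdArc G H }

next : ∀ {m} → Fin (suc m) → Fin (suc m)
next {m} i = fromℕ< (m%n<n (suc (toℕ i)) (suc m))

-- The monochromatic directed cycle of length suc m, all arcs of colour col: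
-- vertices 0,…,m and arcs i → i+1 (mod suc m).
Cycle : (m : ℕ) → Color → BiDigraph
Cycle m col = record
  { V = Fin (suc m)
  ; A = λ c i j → (c ≡ col) × (j ≡ next i) }

record IsBikernel (G : BiDigraph) (B : V G → Set) : Set where
  field
    nonempty    : ∃ λ v → B v
    independent : ∀ u v → B u → B v → u ≢ v → ∀ c → ¬ Path G c u v
    absorbing   : ∀ v → ¬ B v → ∃ λ u → B u × Path G c1 v u
    dominating  : ∀ v → ¬ B v → ∃ λ u → B u × Path G c2 u v

HasBikernel : BiDigraph → Set₁
HasBikernel G = Σ (V G → Set) λ B → IsBikernel G B

-- If both cycles have colour col, the other colour has no arcs at all, so
-- absorption or domination in that colour puts every vertex into the bikernel,
-- contradicting independence along any arc. If the colours differ, walks of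
-- colour col₁ stay inside a row and walks of colour col₂ inside a column. Every
-- row and every column therefore meets the bikernel, and it meets each of them
-- at most once, because two bikernel vertices on a common line are joined by a
-- monochromatic path around that cycle. So the bikernel is the graph of a
-- bijection between the two vertex sets, and for cycles of equal length the
-- diagonal is indeed a bikernel.
module Submission where

open import Defs
open import Data.Empty using (⊥-elim)
open import Data.Fin using (Fin; zero; suc; toℕ; fromℕ; _≟_)
open import Data.Fin.Properties
  using (toℕ-injective; toℕ-fromℕ<; toℕ-fromℕ; toℕ<n; injective⇒≤; sequence)
open import Data.List.Relation.Unary.All using ([])
open import Data.List.Relation.Unary.All.Properties using (¬Any⇒All¬)
open import Data.List.Relation.Unary.AllPairs using ([]; _∷_)
open import Data.List.Relation.Unary.Any using (here; there)
open import Data.List.Relation.Unary.Unique.Propositional using (Unique)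
open import Data.Nat as ℕ using (ℕ; suc; _+_; _∸_; _%_; _≤_; _<_; s≤s; z≤n)
open import Data.Nat.DivMod using (m<n⇒m%n≡m; n%n≡0)
open import Data.Nat.Properties
  using (+-identityʳ; +-suc; m≤m+n; m+[n∸m]≡n; ≤-pred; ≤-trans; ≤-reflexive; ≤-<-trans; ≤-antisym)
open import Data.Product using (∃; _×_; _,_; proj₁; proj₂)
open import Data.Product.Properties using (≡-dec)
open import Data.Sum using (_⊎_; inj₁; inj₂; [_,_])
open import Effect.Monad using (RawMonad)
open import Function using (_∘_)
open import Function.Bundles using (_⇔_; mk⇔)
open import Relation.Binary.Definitions using (DecidableEquality)
open import Relation.Binary.PropositionalEquality using (_≡_; _≢_; refl; sym; trans; cong; subst; module ≡-Reasoning)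
open import Relation.Nullary using (¬_; yes; no)
open import Relation.Nullary.Decidable using (decidable-stable)
open import Relation.Nullary.Negation using (¬¬-Monad; ¬¬-map)

opposite : Color → Color
opposite c1 = c2
opposite c2 = c1

opposite-≢ : ∀ c → opposite c ≢ c
opposite-≢ c1 ()
opposite-≢ c2 ()

two-colours : ∀ {a b : Color} → a ≢ b → ∀ c → c ≡ a ⊎ c ≡ b
two-colours {c1} {c1} a≢b _  = ⊥-elim (a≢b refl)
two-colours {c1} {c2} _   c1 = inj₁ refl
two-colours {c1} {c2} _   c2 = inj₂ refl
two-colours {c2} {c1} _   c1 = inj₂ refl
two-colours {c2} {c1} _   c2 = inj₁ refl
two-colours {c2} {c2} a≢b _  = ⊥-elim (a≢b refl)

NoArcs : BiDigraph → Color → Set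
NoArcs G c = ∀ x y → ¬ A G c x y

StronglyConnected : BiDigraph → Color → Set
StronglyConnected G c = ∀ x y → Walk G c x y

Linked : (G : BiDigraph) → Color → V G → V G → Set
Linked G c u v = Walk G c u v ⊎ Walk G c v u

module _ {G : BiDigraph} {c : Color} where

  _++ʷ_ : ∀ {u v w} → Walk G c u v → Walk G c v w → Walk G c u w
  []      ++ʷ q = q
  (e ∷ p) ++ʷ q = e ∷ (p ++ʷ q)

  walk-without-arcs : NoArcs G c → ∀ {u v} → Walk G c u v → u ≡ v
  walk-without-arcs _      []      = refl
  walk-without-arcs noArcs (e ∷ _) = ⊥-elim (noArcs _ _ e)

  linked-without-arcs : NoArcs G c → ∀ {u v} → Linked G c u v → u ≡ v
  linked-without-arcs noArcs = [ walk-without-arcs noArcs , sym ∘ walk-without-arcs noArcs ]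

  module _ (_≟ᵛ_ : DecidableEquality (V G)) where
    open import Data.List.Membership.DecPropositional _≟ᵛ_ using (_∈_; _∈?_)

    suffix-path : ∀ {u v w} (p : Walk G c v w) → Unique (verts p) → u ∈ verts p → Path G c u w
    suffix-path []      unique (here refl)      = [] , unique
    suffix-path (e ∷ p) unique (here refl)      = e ∷ p , unique
    suffix-path (e ∷ p) (_ ∷ unique) (there u∈p) = suffix-path p unique u∈p

    walk⇒path : ∀ {u v} → Walk G c u v → Path G c u v
    walk⇒path []                   = [] , [] ∷ []
    walk⇒path {u} (e ∷ p) with walk⇒path p
    ... | q , unique with u ∈? verts q
    ...   | yes u∈q = suffix-path q unique u∈q
    ...   | no  u∉q = e ∷ q , ¬Any⇒All¬ _ u∉q ∷ unique

module _ {G : BiDigraph} {B : V G → Set} (bk : IsBikernel G B) where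
  open IsBikernel bk

  kernel-linked : ∀ c v → ¬ ¬ ∃ λ u → B u × Linked G c v u
  kernel-linked c1 v ¬linked with absorbing v (λ Bv → ¬linked (v , Bv , inj₁ []))
  ... | u , Bu , p , _ = ¬linked (u , Bu , inj₁ p)
  kernel-linked c2 v ¬linked with dominating v (λ Bv → ¬linked (v , Bv , inj₁ []))
  ... | u , Bu , p , _ = ¬linked (u , Bu , inj₂ p)

  kernel-full : ∀ {c} → NoArcs G c → ∀ v → ¬ ¬ B v
  kernel-full {c} noArcs v ¬Bv =
    kernel-linked c v λ (u , Bu , v~u) → ¬Bv (subst B (sym (linked-without-arcs noArcs v~u)) Bu)

¬¬-injective⇒≤ : ∀ {m n} (R : Fin m → Fin n → Set) →
  (∀ i → ¬ ¬ ∃ (R i)) → (∀ {i i′ j} → R i j → R i′ j → i ≡ i′) → ¬ ¬ (m ≤ n)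
¬¬-injective⇒≤ R total injective =
  ¬¬-map (λ f → injective⇒≤ (λ {i} {i′} fi≡fi′ →
           injective (proj₂ (f i)) (subst (R i′) (sym fi≡fi′) (proj₂ (f i′)))))
         (sequence (RawMonad.rawApplicative ¬¬-Monad) total)

module _ {G H : BiDigraph} {c : Color} where

  walkˡ : ∀ {a b y} → Walk G c a b → Walk (G □ H) c (a , y) (b , y)
  walkˡ []      = []
  walkˡ (e ∷ p) = left e ∷ walkˡ p

  walkʳ : ∀ {x a b} → Walk H c a b → Walk (G □ H) c (x , a) (x , b)
  walkʳ []      = []
  walkʳ (e ∷ p) = right e ∷ walkʳ p

  walk-proj₁ : NoArcs G c → ∀ {u v} → Walk (G □ H) c u v → proj₁ u ≡ proj₁ v
  walk-proj₁ _      []            = refl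
  walk-proj₁ noArcs (right _ ∷ p) = walk-proj₁ noArcs p
  walk-proj₁ noArcs (left e ∷ _)  = ⊥-elim (noArcs _ _ e)

  walk-proj₂ : NoArcs H c → ∀ {u v} → Walk (G □ H) c u v → proj₂ u ≡ proj₂ v
  walk-proj₂ _      []            = refl
  walk-proj₂ noArcs (left _ ∷ p)  = walk-proj₂ noArcs p
  walk-proj₂ noArcs (right e ∷ _) = ⊥-elim (noArcs _ _ e)

  linked-proj₁ : NoArcs G c → ∀ {u v} → Linked (G □ H) c u v → proj₁ u ≡ proj₁ v
  linked-proj₁ noArcs = [ walk-proj₁ noArcs , sym ∘ walk-proj₁ noArcs ]

  linked-proj₂ : NoArcs H c → ∀ {u v} → Linked (G □ H) c u v → proj₂ u ≡ proj₂ v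
  linked-proj₂ noArcs = [ walk-proj₂ noArcs , sym ∘ walk-proj₂ noArcs ]

  □-noArcs : NoArcs G c → NoArcs H c → NoArcs (G □ H) c
  □-noArcs noArcsᴳ _ _ _ (left e)  = noArcsᴳ _ _ e
  □-noArcs _ noArcsᴴ _ _ (right e) = noArcsᴴ _ _ e

module _ {G H : BiDigraph} {B : V (G □ H) → Set} (bk : IsBikernel (G □ H) B) where
  open IsBikernel bk

  kernel-meets-column : ∀ {c} → NoArcs G c → ∀ x y → ¬ ¬ ∃ λ y′ → B (x , y′)
  kernel-meets-column {c} noArcs x y = ¬¬-map in-column (kernel-linked bk c (x , y))
    where
    in-column : (∃ λ u → B u × Linked (G □ H) c (x , y) u) → ∃ λ y′ → B (x , y′)
    in-column ((x′ , y′) , Bu , v~u) =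
      y′ , subst (λ x″ → B (x″ , y′)) (sym (linked-proj₁ noArcs v~u)) Bu

  kernel-meets-row : ∀ {c} → NoArcs H c → ∀ x y → ¬ ¬ ∃ λ x′ → B (x′ , y)
  kernel-meets-row {c} noArcs x y = ¬¬-map in-row (kernel-linked bk c (x , y))
    where
    in-row : (∃ λ u → B u × Linked (G □ H) c (x , y) u) → ∃ λ x′ → B (x′ , y)
    in-row ((x′ , y′) , Bu , v~u) =
      x′ , subst (λ y″ → B (x′ , y″)) (sym (linked-proj₂ noArcs v~u)) Bu

  module _ (_≟ᴳ_ : DecidableEquality (V G)) (_≟ᴴ_ : DecidableEquality (V H)) where

    kernel-unique-in-column : ∀ {c} → StronglyConnected H c →
      ∀ {x y y′} → B (x , y) → B (x , y′) → y ≡ y′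
    kernel-unique-in-column {c} connected {y = y} {y′} Bu Bv =
      decidable-stable (y ≟ᴴ y′) λ y≢y′ → independent _ _ Bu Bv (y≢y′ ∘ cong proj₂) c
        (walk⇒path (≡-dec _≟ᴳ_ _≟ᴴ_) (walkʳ (connected y y′)))

    kernel-unique-in-row : ∀ {c} → StronglyConnected G c →
      ∀ {x x′ y} → B (x , y) → B (x′ , y) → x ≡ x′
    kernel-unique-in-row {c} connected {x} {x′} Bu Bv =
      decidable-stable (x ≟ᴳ x′) λ x≢x′ → independent _ _ Bu Bv (x≢x′ ∘ cong proj₁) c
        (walk⇒path (≡-dec _≟ᴳ_ _≟ᴴ_) (walkˡ (connected x x′)))

module _ {m : ℕ} {col : Color} where

  toℕ-next : ∀ {i : Fin (suc m)} → suc (toℕ i) < suc m → toℕ (next i) ≡ suc (toℕ i)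
  toℕ-next lt = trans (toℕ-fromℕ< _) (m<n⇒m%n≡m lt)

  next-fromℕ : next (fromℕ m) ≡ zero
  next-fromℕ = toℕ-injective (begin
    toℕ (next (fromℕ m))        ≡⟨ toℕ-fromℕ< _ ⟩
    suc (toℕ (fromℕ m)) % suc m ≡⟨ cong (λ k → suc k % suc m) (toℕ-fromℕ m) ⟩
    suc m % suc m               ≡⟨ n%n≡0 (suc m) ⟩
    0                           ∎)
    where open ≡-Reasoning

  ascending-walk : ∀ d {i j : Fin (suc m)} → toℕ i + d ≡ toℕ j → Walk (Cycle m col) col i j
  ascending-walk ℕ.zero {i} {j} i+0≡j
    with toℕ-injective {i = i} {j} (trans (sym (+-identityʳ _)) i+0≡j)
  ... | refl = []
  ascending-walk (suc d) {i} {j} i+d+1≡j = (refl , refl) ∷ ascending-walk d next-i+d≡j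
    where
    i+1+d≡j : suc (toℕ i) + d ≡ toℕ j
    i+1+d≡j = trans (sym (+-suc (toℕ i) d)) i+d+1≡j

    i+1<1+m : suc (toℕ i) < suc m
    i+1<1+m = ≤-<-trans (≤-trans (m≤m+n _ d) (≤-reflexive i+1+d≡j)) (toℕ<n j)

    next-i+d≡j : toℕ (next i) + d ≡ toℕ j
    next-i+d≡j = trans (cong (_+ d) (toℕ-next i+1<1+m)) i+1+d≡j

  Cycle-stronglyConnected : StronglyConnected (Cycle m col) col
  Cycle-stronglyConnected i j =
    ascending-walk (m ∸ toℕ i) (trans (m+[n∸m]≡n (≤-pred (toℕ<n i))) (sym (toℕ-fromℕ m)))
    ++ʷ ((refl , sym next-fromℕ) ∷ ascending-walk (toℕ j) refl)

  Cycle-noArcs : ∀ {c} → c ≢ col → NoArcs (Cycle m col) c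
  Cycle-noArcs c≢col _ _ (c≡col , _) = c≢col c≡col

module _ {m₁ m₂ : ℕ} {col₁ col₂ : Color} where

  private
    G : BiDigraph
    G = Cycle m₁ col₁ □ Cycle m₂ col₂

  -- B need not be decidable, so the two injections exist only under double
  -- negation; that suffices because equality of lengths is decidable.
  bikernel⇒same-length : col₁ ≢ col₂ → ∀ {B} → IsBikernel G B → suc m₁ ≡ suc m₂
  bikernel⇒same-length col₁≢col₂ {B} bk = decidable-stable (suc m₁ ℕ.≟ suc m₂) λ m₁≢m₂ →
    m₂≤m₁ λ le₂₁ → m₁≤m₂ λ le₁₂ → m₁≢m₂ (≤-antisym le₁₂ le₂₁)
    where
    m₂≤m₁ : ¬ ¬ (suc m₂ ≤ suc m₁)
    m₂≤m₁ = ¬¬-injective⇒≤ (λ y x → B (x , y))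
      (kernel-meets-row bk (Cycle-noArcs col₁≢col₂) zero)
      (kernel-unique-in-column bk _≟_ _≟_ Cycle-stronglyConnected)

    m₁≤m₂ : ¬ ¬ (suc m₁ ≤ suc m₂)
    m₁≤m₂ = ¬¬-injective⇒≤ (λ x y → B (x , y))
      (λ x → kernel-meets-column bk (Cycle-noArcs (col₁≢col₂ ∘ sym)) x zero)
      (kernel-unique-in-row bk _≟_ _≟_ Cycle-stronglyConnected)

bikernel⇒colours-differ : ∀ {m₁ m₂ col₁ col₂ B} →
  IsBikernel (Cycle (suc m₁) col₁ □ Cycle m₂ col₂) B → col₁ ≢ col₂
bikernel⇒colours-differ {m₁} {m₂} {col₁ = col} {B = B} bk refl =
  ¬¬B u λ Bu → ¬¬B v λ Bv →
    independent u v Bu Bv (λ ()) col (walk⇒path (≡-dec _≟_ _≟_) (left (refl , refl) ∷ []))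
  where
  open IsBikernel bk
  u v : Fin (suc (suc m₁)) × Fin (suc m₂)
  u = zero , zero
  v = suc zero , zero

  ¬¬B : ∀ w → ¬ ¬ B w
  ¬¬B = kernel-full bk (□-noArcs (Cycle-noArcs (opposite-≢ col)) (Cycle-noArcs (opposite-≢ col)))

module _ {m : ℕ} {col₁ col₂ : Color} (col₁≢col₂ : col₁ ≢ col₂) where

  private
    G : BiDigraph
    G = Cycle m col₁ □ Cycle m col₂

  Diagonal : V G → Set
  Diagonal (x , y) = x ≡ y

  diagonal-linked : ∀ {c} → c ≡ col₁ ⊎ c ≡ col₂ →
    ∀ x y → ∃ λ k → Walk G c (x , y) (k , k) × Walk G c (k , k) (x , y)
  diagonal-linked (inj₁ refl) x y =
    y , walkˡ (Cycle-stronglyConnected x y) , walkˡ (Cycle-stronglyConnected y x)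
  diagonal-linked (inj₂ refl) x y =
    x , walkʳ (Cycle-stronglyConnected y x) , walkʳ (Cycle-stronglyConnected x y)

  diagonal-walk-trivial : ∀ {c x y} → c ≡ col₁ ⊎ c ≡ col₂ → Walk G c (x , x) (y , y) → x ≡ y
  diagonal-walk-trivial (inj₁ refl) = walk-proj₂ (Cycle-noArcs col₁≢col₂)
  diagonal-walk-trivial (inj₂ refl) = walk-proj₁ (Cycle-noArcs (col₁≢col₂ ∘ sym))

  diagonal-isBikernel : IsBikernel G Diagonal
  diagonal-isBikernel = record
    { nonempty    = (zero , zero) , refl
    ; independent = λ { (x , _) (y , _) refl refl u≢v c (p , _) →
                        u≢v (cong (λ k → k , k) (diagonal-walk-trivial (two-colours col₁≢col₂ c) p)) }
    ; absorbing   = λ { (x , y) _ → let k , to , _ = linked c1 x y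
                                     in (k , k) , refl , walk⇒path dec to }
    ; dominating  = λ { (x , y) _ → let k , _ , from = linked c2 x y
                                     in (k , k) , refl , walk⇒path dec from }
    }
    where
    dec : DecidableEquality (V G)
    dec = ≡-dec _≟_ _≟_

    linked : ∀ c x y → ∃ λ k → Walk G c (x , y) (k , k) × Walk G c (k , k) (x , y)
    linked c = diagonal-linked (two-colours col₁≢col₂ c)

mainTheorem7 : (m₁ m₂ : ℕ) → 1 ≤ m₁ → 1 ≤ m₂ → (col₁ col₂ : Color) →
    HasBikernel (Cycle m₁ col₁ □ Cycle m₂ col₂) ⇔ (suc m₁ ≡ suc m₂ × col₁ ≢ col₂)
mainTheorem7 (suc m₁) m₂ (s≤s z≤n) _ col₁ col₂ = mk⇔ necessary sufficient
  where
  necessary : HasBikernel (Cycle (suc m₁) col₁ □ Cycle m₂ col₂) →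
              suc (suc m₁) ≡ suc m₂ × col₁ ≢ col₂
  necessary (_ , bk) = bikernel⇒same-length col₁≢col₂ bk , col₁≢col₂
    where
    col₁≢col₂ : col₁ ≢ col₂
    col₁≢col₂ = bikernel⇒colours-differ bk

  sufficient : suc (suc m₁) ≡ suc m₂ × col₁ ≢ col₂ →
               HasBikernel (Cycle (suc m₁) col₁ □ Cycle m₂ col₂)
  sufficient (refl , col₁≢col₂) = Diagonal col₁≢col₂ , diagonal-isBikernel col₁≢col₂
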